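{- Every sequence over $C_3^3$ of length $16$ that contains no short zero-sum subsequence has sum zero.
   Context: $C_3^3$ is the direct sum of three copies of the cyclic group of order $3$. A sequence is a finite unordered list of group elements with repetition allowed; length counts multiplicity. A short zero-sum subsequence is a subsequence with sum $0$ and length in $[1,3]$. -}

module Defs where

open import Data.Nat using (ℕ; _+_)
open import Data.Nat.DivMod using (_mod_)
open import Data.Fin using (Fin; toℕ; zero)
open import Data.Product using (_×_; _,_)
open import Data.List using (List; foldr; length)
open import Data.List.Relation.Binary.Sublist.Propositional using (_⊆_)
open import Data.Nat using (_≤_; _<_)
open import Relation.Nullary using (¬_)
open import Relation.Binary.PropositionalEquality using (_≡_)

C3 : Set
C3 = Fin 3

_+₃_ : C3 → C3 → C3
a +₃ b = (toℕ a + toℕ b) mod 3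

G : Set
G = C3 × C3 × C3

0G : G
0G = zero , zero , zero

_⊕_ : G → G → G
(a₁ , a₂ , a₃) ⊕ (b₁ , b₂ , b₃) = (a₁ +₃ b₁) , (a₂ +₃ b₂) , (a₃ +₃ b₃)

-- A sequence over G (finite, unordered, repetition allowed) is represented
-- by a list; the order is irrelevant for everything below.
Seq : Set
Seq = List G

σ : Seq → G
σ = foldr _⊕_ 0G

-- Subsequences = sub-multisets, represented by sublists of the list.
IsShortZeroSum : Seq → Seq → Set
IsShortZeroSum S T = (T ⊆ S) × (1 ≤ length T) × (length T ≤ 3) × (σ T ≡ 0G)

HasNoShortZeroSum : Seq → Set
HasNoShortZeroSum S = ∀ (T : Seq) → ¬ IsShortZeroSum S T

-- Having no short zero-sum subsequence means: 0 does
-- not occur, no element occurs three times, x and -x never both occur, and no three distinct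
-- occurring elements sum to 0; that is, the support A of S together with 0 is a cap in F₃³.
-- Split the 26 nonzero elements into 13 pairs {r, -r}. Each pair contributes at most 2 to the
-- length, so a sequence of length 16 meets at least 8 pairs. A pruned exhaustive search over
-- the pairs shows that every such cap has exactly 8 nonzero points and that they sum to 0.
-- Hence every element of A occurs exactly twice and σ S = 2 σ A = 0.
module Submission where

open import Defs
open import Data.List using (length)
open import Relation.Binary.PropositionalEquality using (_≡_)

open import Algebra.Bundles using (CommutativeMonoid)
open import Algebra.Core using (Op₂)
import Algebra.Definitions.RawMonoid as RawMonoidDefinitions
import Algebra.Properties.CommutativeSemigroup as CommutativeSemigroupProperties
open import Algebra.Structures using (IsCommutativeMonoid)
open import Algebra.Structures.Biased using (isCommutativeMonoidˡ)
open import Data.Bool using (Bool; T; _∧_; _∨_; not)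
open import Data.Bool.Properties using (T-∧; T-∨)
open import Data.Empty using (⊥; ⊥-elim)
import Data.Fin as Fin
import Data.Fin.Properties as Fin
open import Data.List using (List; []; _∷_; foldr; filter; replicate)
open import Data.List.Membership.Propositional using (_∈_; _∉_)
open import Data.List.Membership.Propositional.Properties using (∈-∃++)
open import Data.List.Properties
  using (filter-accept; filter-reject; filter-some; filter-none; filter-all; length-replicate)
open import Data.List.Relation.Binary.Permutation.Propositional
  using (_↭_; ↭-refl; ↭-sym; ↭-trans; ↭-prep; ↭⇒↭ₛ)
open import Data.List.Relation.Binary.Permutation.Propositional.Properties using (↭-length; filter-↭; shift)
import Data.List.Relation.Binary.Permutation.Setoid.Properties as PermutationProperties
open import Data.List.Relation.Binary.Sublist.Propositional using (_⊆_; []; _∷_; _∷ʳ_)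
open import Data.List.Relation.Unary.All as All using (All; []; _∷_)
open import Data.List.Relation.Unary.All.Properties using (¬Any⇒All¬; All¬⇒¬Any; replicate⁺)
open import Data.List.Relation.Unary.AllPairs using ([]; _∷_)
open import Data.List.Relation.Unary.Any using (here; there)
open import Data.List.Relation.Unary.Unique.Propositional using (Unique)
open import Data.Nat
  using (ℕ; zero; suc; _+_; _*_; _≤_; _<_; z≤n; s≤s; s≤s⁻¹; _<?_; _<ᵇ_; _≡ᵇ_)
  renaming (_≟_ to _≟ℕ_)
open import Data.Nat.Properties
  using ( +-0-isCommutativeMonoid; +-commutativeSemigroup; +-identityʳ; +-assoc; *-suc; *-distribˡ-+
        ; ≤-refl; ≤-reflexive; ≤-trans; ≤-antisym; ≤-<-trans; m≤n⇒m≤1+n; n≤0⇒n≡0; n≮0; <⇒≢; ≮⇒≥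
        ; +-mono-≤; +-mono-<-≤; *-monoʳ-<; +-cancelˡ-≡; <ᵇ⇒<; ≡ᵇ⇒≡ )
open import Data.Product using (_×_; _,_; ∃-syntax)
open import Data.Product.Properties using (≡-dec)
open import Data.Sum using (_⊎_; inj₁; inj₂)
open import Function using (_∘_; Equivalence)
open import Level using (0ℓ)
open import Relation.Binary.Definitions using (DecidableEquality)
open import Relation.Binary.PropositionalEquality
  using (_≢_; refl; sym; trans; cong; cong₂; subst; subst₂; setoid; module ≡-Reasoning)
open import Relation.Binary.PropositionalEquality.Algebra using (isMagma)
open import Relation.Nullary using (¬_; Dec; yes; no)
open import Relation.Nullary.Decidable
  using (⌊_⌋; map′; from-yes; toWitness; toWitnessFalse; ¬?; _→-dec_)
open import Relation.Unary using (Pred; Decidable)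

infix 4 _≟_
_≟_ : DecidableEquality G
_≟_ = ≡-dec Fin._≟_ (≡-dec Fin._≟_ Fin._≟_)

open import Data.List.Membership.DecPropositional _≟_ using (_∈?_)
open import Data.List.Relation.Unary.Unique.DecPropositional _≟_ using (unique?)

all? : {P : Pred G 0ℓ} → Decidable P → Dec (∀ x → P x)
all? P? = map′ (λ ∀P (a , b , c) → ∀P a b c) (λ ∀P a b c → ∀P (a , b , c))
  (Fin.all? λ a → Fin.all? λ b → Fin.all? λ c → P? (a , b , c))

⊕-assoc : ∀ x y z → (x ⊕ y) ⊕ z ≡ x ⊕ (y ⊕ z)
⊕-assoc = from-yes (all? λ x → all? λ y → all? λ z → (x ⊕ y) ⊕ z ≟ x ⊕ (y ⊕ z))

⊕-comm : ∀ x y → x ⊕ y ≡ y ⊕ x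
⊕-comm = from-yes (all? λ x → all? λ y → x ⊕ y ≟ y ⊕ x)

⊕-identityˡ : ∀ x → 0G ⊕ x ≡ x
⊕-identityˡ = from-yes (all? λ x → 0G ⊕ x ≟ x)

⊕-0G-isCommutativeMonoid : IsCommutativeMonoid _≡_ _⊕_ 0G
⊕-0G-isCommutativeMonoid = isCommutativeMonoidˡ record
  { isSemigroup = record { isMagma = isMagma _⊕_ ; assoc = ⊕-assoc }
  ; identityˡ   = ⊕-identityˡ
  ; comm        = ⊕-comm
  }

⊕-0G-commutativeMonoid : CommutativeMonoid 0ℓ 0ℓ
⊕-0G-commutativeMonoid = record { isCommutativeMonoid = ⊕-0G-isCommutativeMonoid }

open CommutativeMonoid ⊕-0G-commutativeMonoid using () renaming (identityʳ to ⊕-identityʳ)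

module ⊕-Properties =
  CommutativeSemigroupProperties (CommutativeMonoid.commutativeSemigroup ⊕-0G-commutativeMonoid)
module +-Properties = CommutativeSemigroupProperties +-commutativeSemigroup

σ-↭ : ∀ {xs ys} → xs ↭ ys → σ xs ≡ σ ys
σ-↭ = PermutationProperties.foldr-commMonoid (setoid G) ⊕-0G-isCommutativeMonoid ∘ ↭⇒↭ₛ

-₃_ : C3 → C3
-₃ Fin.zero                   = Fin.zero
-₃ Fin.suc Fin.zero           = Fin.suc (Fin.suc Fin.zero)
-₃ Fin.suc (Fin.suc Fin.zero) = Fin.suc Fin.zero

⊖_ : G → G
⊖ (a , b , c) = -₃ a , -₃ b , -₃ c

⊖-fixed⇒≡0G : ∀ x → ⊖ x ≡ x → x ≡ 0G
⊖-fixed⇒≡0G = from-yes (all? λ x → (⊖ x ≟ x) →-dec (x ≟ 0G))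

⊖[x⊕y]≡y⇒x≡y : ∀ x y → ⊖ (x ⊕ y) ≡ y → x ≡ y
⊖[x⊕y]≡y⇒x≡y = from-yes (all? λ x → all? λ y → (⊖ (x ⊕ y) ≟ y) →-dec (x ≟ y))

σ-triple : ∀ x → σ (x ∷ x ∷ x ∷ []) ≡ 0G
σ-triple = from-yes (all? λ x → σ (x ∷ x ∷ x ∷ []) ≟ 0G)

σ-antipodal : ∀ x → σ (x ∷ ⊖ x ∷ []) ≡ 0G
σ-antipodal = from-yes (all? λ x → σ (x ∷ ⊖ x ∷ []) ≟ 0G)

σ-line : ∀ x y → σ (x ∷ y ∷ ⊖ (x ⊕ y) ∷ []) ≡ 0G
σ-line = from-yes (all? λ x → all? λ y → σ (x ∷ y ∷ ⊖ (x ⊕ y) ∷ []) ≟ 0G)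

-- Opaque, so that a case split on x ≟ y never unfolds the filter inside count.
opaque
  count : G → List G → ℕ
  count x = length ∘ filter (x ≟_)

  count-here : ∀ x xs → count x (x ∷ xs) ≡ suc (count x xs)
  count-here x xs = cong length (filter-accept (x ≟_) refl)

  count-there : ∀ {x y} xs → x ≢ y → count x (y ∷ xs) ≡ count x xs
  count-there {x} xs x≢y = cong length (filter-reject (x ≟_) x≢y)

  count-none : ∀ {x xs} → All (x ≢_) xs → count x xs ≡ 0
  count-none {x} x∉xs = cong length (filter-none (x ≟_) x∉xs)

  ∈⇒count>0 : ∀ {x xs} → x ∈ xs → 0 < count x xs
  ∈⇒count>0 {x} = filter-some (x ≟_)

  count-↭ : ∀ {x xs ys} → xs ↭ ys → count x xs ≡ count x ys
  count-↭ {x} = ↭-length ∘ filter-↭ (x ≟_)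

  count-replicate : ∀ n x → count x (replicate n x) ≡ n
  count-replicate n x =
    trans (cong length (filter-all (x ≟_) (replicate⁺ n refl))) (length-replicate n)

count-unique : ∀ {x xs} → Unique xs → count x xs ≤ 1
count-unique {xs = []} [] = m≤n⇒m≤1+n (≤-reflexive (count-none []))
count-unique {x} {y ∷ ys} (y∉ys ∷ ys-unique) with x ≟ y
... | yes refl = ≤-reflexive (trans (count-here x ys) (cong suc (count-none y∉ys)))
... | no x≢y   = subst (_≤ 1) (sym (count-there ys x≢y)) (count-unique ys-unique)

module Tally {M : Set} {_∙_ : Op₂ M} {ε : M} (isCommutativeMonoid : IsCommutativeMonoid _≡_ _∙_ ε) where

  private
    commutativeMonoid : CommutativeMonoid 0ℓ 0ℓ
    commutativeMonoid = record { isCommutativeMonoid = isCommutativeMonoid }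
    open CommutativeMonoid commutativeMonoid
      using (identityˡ; identityʳ; commutativeSemigroup; rawMonoid)
    open CommutativeSemigroupProperties commutativeSemigroup using (interchange; x∙yz≈y∙xz)

  open RawMonoidDefinitions rawMonoid public using () renaming (_×_ to _·_)
  open ≡-Reasoning

  ∑ : (G → M) → List G → M
  ∑ f = foldr (λ x → f x ∙_) ε

  ∑-cong : ∀ {f g} → (∀ x → f x ≡ g x) → ∀ xs → ∑ f xs ≡ ∑ g xs
  ∑-cong f≗g []       = refl
  ∑-cong f≗g (x ∷ xs) = cong₂ _∙_ (f≗g x) (∑-cong f≗g xs)

  ∑-ε : ∀ xs → ∑ (λ _ → ε) xs ≡ ε
  ∑-ε []       = refl
  ∑-ε (x ∷ xs) = trans (identityˡ _) (∑-ε xs)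

  ∑-count-∷ : ∀ (f : G → M) s S U →
              ∑ (λ u → count u (s ∷ S) · f u) U ≡ (count s U · f s) ∙ ∑ (λ u → count u S · f u) U
  ∑-count-∷ f s S []      = sym (trans (cong (λ m → (m · f s) ∙ ε) (count-none [])) (identityˡ ε))
  ∑-count-∷ f s S (u ∷ U) with u ≟ s
  ... | yes refl = begin
    (count u (u ∷ S) · f u) ∙ ∑ (λ v → count v (u ∷ S) · f v) U
      ≡⟨ cong₂ (λ m w → (m · f u) ∙ w) (count-here u S) (∑-count-∷ f u S U) ⟩
    (f u ∙ (count u S · f u)) ∙ ((count u U · f u) ∙ rest)
      ≡⟨ interchange _ _ _ _ ⟩
    (f u ∙ (count u U · f u)) ∙ ((count u S · f u) ∙ rest)
      ≡⟨ cong (λ m → (m · f u) ∙ ((count u S · f u) ∙ rest)) (count-here u U) ⟨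
    (count u (u ∷ U) · f u) ∙ ((count u S · f u) ∙ rest) ∎
    where rest = ∑ (λ v → count v S · f v) U
  ... | no u≢s = begin
    (count u (s ∷ S) · f u) ∙ ∑ (λ v → count v (s ∷ S) · f v) U
      ≡⟨ cong₂ (λ m w → (m · f u) ∙ w) (count-there S u≢s) (∑-count-∷ f s S U) ⟩
    (count u S · f u) ∙ ((count s U · f s) ∙ rest)
      ≡⟨ x∙yz≈y∙xz _ _ _ ⟩
    (count s U · f s) ∙ ((count u S · f u) ∙ rest)
      ≡⟨ cong (λ m → (m · f s) ∙ ((count u S · f u) ∙ rest)) (count-there U (u≢s ∘ sym)) ⟨
    (count s (u ∷ U) · f s) ∙ ((count u S · f u) ∙ rest) ∎
    where rest = ∑ (λ v → count v S · f v) U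

  ∑-count : ∀ {U} → (∀ x → count x U ≡ 1) → ∀ (f : G → M) S → ∑ (λ u → count u S · f u) U ≡ ∑ f S
  ∑-count {U} once f []      = trans (∑-cong (λ u → cong (_· f u) (count-none [])) U) (∑-ε U)
  ∑-count {U} once f (s ∷ S) = begin
    ∑ (λ u → count u (s ∷ S) · f u) U
      ≡⟨ ∑-count-∷ f s S U ⟩
    (count s U · f s) ∙ ∑ (λ u → count u S · f u) U
      ≡⟨ cong₂ (λ m w → (m · f s) ∙ w) (once s) (∑-count once f S) ⟩
    (f s ∙ ε) ∙ ∑ f S
      ≡⟨ cong (_∙ ∑ f S) (identityʳ (f s)) ⟩
    f s ∙ ∑ f S ∎

module ⊕-Tally = Tally ⊕-0G-isCommutativeMonoid
module +-Tally = Tally +-0-isCommutativeMonoid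
open ⊕-Tally using (_·_)

weightedSum : (G → ℕ) → List G → G
weightedSum c = ⊕-Tally.∑ (λ x → c x · x)

weight : (G → ℕ) → List G → ℕ
weight = +-Tally.∑

σ≡weightedSum-count : ∀ {U} → (∀ x → count x U ≡ 1) → ∀ S → σ S ≡ weightedSum (λ x → count x S) U
σ≡weightedSum-count once S = sym (⊕-Tally.∑-count once (λ x → x) S)

length≡weight-count : ∀ {U} → (∀ x → count x U ≡ 1) → ∀ S → length S ≡ weight (λ x → count x S) U
length≡weight-count {U} once S =
  sym (trans (+-Tally.∑-cong (λ x → sym (·1≡ (count x S))) U) (+-Tally.∑-count once (λ _ → 1) S))
  where
  ·1≡ : ∀ n → n +-Tally.· 1 ≡ n
  ·1≡ zero    = refl
  ·1≡ (suc n) = cong suc (·1≡ n)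

infix 4 _≼_
_≼_ : List G → List G → Set
T ≼ S = ∀ x → count x T ≤ count x S

≼-drop : ∀ {s T S} → s ∉ T → T ≼ s ∷ S → T ≼ S
≼-drop {s} {T} {S} s∉T T≼sS x with x ≟ s
... | yes refl = subst (_≤ count s S) (sym (count-none (¬Any⇒All¬ T s∉T))) z≤n
... | no x≢s   = subst (count x T ≤_) (count-there S x≢s) (T≼sS x)

≼-∷⁻ : ∀ {s T S} → s ∷ T ≼ s ∷ S → T ≼ S
≼-∷⁻ {s} {T} {S} sT≼sS x with x ≟ s
... | yes refl = s≤s⁻¹ (subst₂ _≤_ (count-here s T) (count-here s S) (sT≼sS s))
... | no x≢s   = subst₂ _≤_ (count-there T x≢s) (count-there S x≢s) (sT≼sS x)

≼⇒⊆-↭ : ∀ {T} S → T ≼ S → ∃[ T′ ] T′ ⊆ S × T′ ↭ T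
≼⇒⊆-↭ {[]}    []      _    = [] , [] , ↭-refl
≼⇒⊆-↭ {x ∷ T} []      T≼[] =
  ⊥-elim (n≮0 (subst (0 <_) (count-none []) (≤-trans (∈⇒count>0 (here refl)) (T≼[] x))))
≼⇒⊆-↭ {T}     (s ∷ S) T≼sS with s ∈? T
... | no s∉T =
  let T′ , T′⊆S , T′↭T = ≼⇒⊆-↭ S (≼-drop s∉T T≼sS)
  in T′ , s ∷ʳ T′⊆S , T′↭T
... | yes s∈T with ys , zs , refl ← ∈-∃++ s∈T =
  let T↭sT₀ = shift s ys zs
      T′ , T′⊆S , T′↭T₀ = ≼⇒⊆-↭ S (≼-∷⁻ λ x → subst (_≤ count x (s ∷ S)) (count-↭ T↭sT₀) (T≼sS x))
  in s ∷ T′ , refl ∷ T′⊆S , ↭-trans (↭-prep s T′↭T₀) (↭-sym T↭sT₀)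

unique-≼ : ∀ {T S} → Unique T → All (λ x → 0 < count x S) T → T ≼ S
unique-≼ {T} {S} T-unique T-present x with x ∈? T
... | yes x∈T = ≤-trans (count-unique T-unique) (All.lookup T-present x∈T)
... | no x∉T  = subst (_≤ count x S) (sym (count-none (¬Any⇒All¬ T x∉T))) z≤n

replicate-≼ : ∀ {n x S} → n ≤ count x S → replicate n x ≼ S
replicate-≼ {n} {x} {S} n≤count y with y ≟ x
... | yes refl = subst (_≤ count x S) (sym (count-replicate n x)) n≤count
... | no y≢x   = subst (_≤ count y S) (sym (count-none (replicate⁺ n y≢x))) z≤n

record ShortZeroSumFree (c : G → ℕ) : Set where
  field
    zero-absent        : c 0G ≡ 0
    at-most-twice      : ∀ x → c x ≤ 2
    no-antipodal-pair  : ∀ x → 0 < c x → 0 < c (⊖ x) → ⊥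
    no-zero-sum-triple : ∀ x y → x ≢ y → 0 < c x → 0 < c y → 0 < c (⊖ (x ⊕ y)) → ⊥

module _ {S : Seq} (no-short : HasNoShortZeroSum S) where

  no-short-≼ : ∀ T → T ≼ S → 1 ≤ length T → length T ≤ 3 → σ T ≢ 0G
  no-short-≼ T T≼S 1≤|T| |T|≤3 σT≡0G =
    let T′ , T′⊆S , T′↭T = ≼⇒⊆-↭ S T≼S
        |T′|≡|T| = ↭-length T′↭T
    in no-short T′ ( T′⊆S
                   , subst (1 ≤_) (sym |T′|≡|T|) 1≤|T|
                   , subst (_≤ 3) (sym |T′|≡|T|) |T|≤3
                   , trans (σ-↭ T′↭T) σT≡0G )

  0G∉S : ¬ 0 < count 0G S
  0G∉S 0G∈S = no-short-≼ (0G ∷ []) (replicate-≼ 0G∈S) (s≤s z≤n) (s≤s z≤n) refl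

  shortZeroSumFree : ShortZeroSumFree (λ x → count x S)
  shortZeroSumFree = record
    { zero-absent        = n≤0⇒n≡0 (≮⇒≥ 0G∉S)
    ; at-most-twice      = λ x → ≮⇒≥ λ 2<c →
        no-short-≼ (x ∷ x ∷ x ∷ []) (replicate-≼ 2<c) (s≤s z≤n) ≤-refl (σ-triple x)
    ; no-antipodal-pair  = λ x x∈S ⊖x∈S →
        let x≢⊖x : x ≢ ⊖ x
            x≢⊖x x≡⊖x = 0G∉S (subst (λ y → 0 < count y S) (⊖-fixed⇒≡0G x (sym x≡⊖x)) x∈S)
        in no-short-≼ (x ∷ ⊖ x ∷ []) (unique-≼ ((x≢⊖x ∷ []) ∷ [] ∷ []) (x∈S ∷ ⊖x∈S ∷ []))
             (s≤s z≤n) (s≤s (s≤s z≤n)) (σ-antipodal x)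
    ; no-zero-sum-triple = λ x y x≢y x∈S y∈S z∈S →
        let x≢z : x ≢ ⊖ (x ⊕ y)
            x≢z x≡z = x≢y (sym (⊖[x⊕y]≡y⇒x≡y y x (trans (cong ⊖_ (⊕-comm y x)) (sym x≡z))))
            y≢z : y ≢ ⊖ (x ⊕ y)
            y≢z y≡z = x≢y (⊖[x⊕y]≡y⇒x≡y x y (sym y≡z))
        in no-short-≼ (x ∷ y ∷ ⊖ (x ⊕ y) ∷ [])
             (unique-≼ ((x≢y ∷ x≢z ∷ []) ∷ (y≢z ∷ []) ∷ [] ∷ []) (x∈S ∷ y∈S ∷ z∈S ∷ []))
             (s≤s z≤n) ≤-refl (σ-line x y)
    }

pairs : List G → List G
pairs []       = []
pairs (r ∷ rs) = r ∷ ⊖ r ∷ pairs rs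

Compatible : G → List G → Set
Compatible x A = All (λ y → ⊖ (x ⊕ y) ∉ A) A

compatible? : ∀ x A → Dec (Compatible x A)
compatible? x A = All.all? (λ y → ¬? (⊖ (x ⊕ y) ∈? A)) A

-- Search n rs A: every way of adding to A at most one element of each pair {r, ⊖ r}, r ∈ rs,
-- keeping each added element compatible with those before it, reaches at most n elements, and
-- if exactly n then their sum is 0G. Branches that cannot reach n elements are cut off.
mutual
  Search : ℕ → List G → List G → Set
  Search n rs A = length A + length rs < n ⊎ Branch n rs A

  Branch : ℕ → List G → List G → Set
  Branch n []       A = length A ≡ n × σ A ≡ 0G
  Branch n (r ∷ rs) A = Search n rs A × Extends r × Extends (⊖ r)
    where
    Extends : G → Set
    Extends x = Compatible x A → Search n rs (x ∷ A)

mutual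
  search : ℕ → List G → List G → Bool
  search n rs A = (length A + length rs <ᵇ n) ∨ branch n rs A

  branch : ℕ → List G → List G → Bool
  branch n []       A = (length A ≡ᵇ n) ∧ ⌊ σ A ≟ 0G ⌋
  branch n (r ∷ rs) A = search n rs A ∧ extends r ∧ extends (⊖ r)
    where
    extends : G → Bool
    extends x = not ⌊ compatible? x A ⌋ ∨ search n rs (x ∷ A)

mutual
  search-correct : ∀ n rs A → T (search n rs A) → Search n rs A
  search-correct n rs A s with Equivalence.to T-∨ s
  ... | inj₁ short = inj₁ (<ᵇ⇒< _ _ short)
  ... | inj₂ b     = inj₂ (branch-correct n rs A b)

  branch-correct : ∀ n rs A → T (branch n rs A) → Branch n rs A
  branch-correct n [] A b =
    let |A|≡n , σA≡0G = Equivalence.to T-∧ b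
    in ≡ᵇ⇒≡ _ _ |A|≡n , toWitness {a? = σ A ≟ 0G} σA≡0G
  branch-correct n (r ∷ rs) A b =
    let s , e = Equivalence.to T-∧ b
        e₊ , e₋ = Equivalence.to T-∧ e
    in search-correct n rs A s , extends-correct r e₊ , extends-correct (⊖ r) e₋
    where
    extends-correct : ∀ x → T (not ⌊ compatible? x A ⌋ ∨ search n rs (x ∷ A)) →
                      Compatible x A → Search n rs (x ∷ A)
    extends-correct x e compatible with Equivalence.to T-∨ e
    ... | inj₁ incompatible = ⊥-elim (toWitnessFalse {a? = compatible? x A} incompatible compatible)
    ... | inj₂ s            = search-correct n rs (x ∷ A) s

fresh⇒∉ : ∀ {x : G} {A B : List G} → All (_∉ B) A → x ∈ B → x ∉ A
fresh⇒∉ A-fresh x∈B x∈A = All.lookup A-fresh x∈A x∈B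

fresh-tail : ∀ {r rs A} → All (_∉ pairs (r ∷ rs)) A → All (_∉ pairs rs) A
fresh-tail = All.map (_∘ there ∘ there)

+-tight : ∀ {a b m n} → a ≤ m → b ≤ n → a + b ≡ m + n → a ≡ m × b ≡ n
+-tight {a} {b} {m} a≤m b≤n a+b≡m+n =
  let a≡m = ≤-antisym a≤m (≮⇒≥ λ a<m → <⇒≢ (+-mono-<-≤ a<m b≤n) a+b≡m+n)
  in a≡m , +-cancelˡ-≡ m b _ (trans (cong (_+ b) (sym a≡m)) a+b≡m+n)

module _ {c : G → ℕ} (free : ShortZeroSumFree c) where

  open ShortZeroSumFree free
  open ≡-Reasoning

  private
    W : List G → G
    W = weightedSum c

    N : List G → ℕ
    N = weight c

  Vanishes : ℕ → List G → List G → Set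
  Vanishes w A L = N A + N L ≡ w → W A ⊕ W L ≡ 0G

  absent : ∀ {x} → ¬ 0 < c x → c x ≡ 0
  absent = n≤0⇒n≡0 ∘ ≮⇒≥

  absent-∷ : ∀ {w} A L {x} → c x ≡ 0 → Vanishes w A L → Vanishes w A (x ∷ L)
  absent-∷ {w} A L {x} cx≡0 vanishes N≡w = begin
    W A ⊕ ((c x · x) ⊕ W L) ≡⟨ cong (λ k → W A ⊕ ((k · x) ⊕ W L)) cx≡0 ⟩
    W A ⊕ (0G ⊕ W L)        ≡⟨ cong (W A ⊕_) (⊕-identityˡ (W L)) ⟩
    W A ⊕ W L               ≡⟨ vanishes (subst (λ k → N A + (k + N L) ≡ w) cx≡0 N≡w) ⟩
    0G                      ∎

  shift-∷ : ∀ {w} A L x → Vanishes w (x ∷ A) L → Vanishes w A (x ∷ L)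
  shift-∷ A L x vanishes N≡w = begin
    W A ⊕ ((c x · x) ⊕ W L) ≡⟨ ⊕-Properties.xy∙z≈y∙xz (c x · x) (W A) (W L) ⟨
    W (x ∷ A) ⊕ W L         ≡⟨ vanishes (trans (+-Properties.xy∙z≈y∙xz (c x) (N A) (N L)) N≡w) ⟩
    0G                      ∎

  weight≤ : ∀ xs → N xs ≤ 2 * length xs
  weight≤ []       = z≤n
  weight≤ (x ∷ xs) = subst (N (x ∷ xs) ≤_) (sym (*-suc 2 (length xs)))
    (+-mono-≤ (at-most-twice x) (weight≤ xs))

  pair-weight≤ : ∀ r → c r + c (⊖ r) ≤ 2
  pair-weight≤ r with 0 <? c r
  ... | yes r∈ = subst (λ k → c r + k ≤ 2) (sym (absent (no-antipodal-pair r r∈)))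
                   (subst (_≤ 2) (sym (+-identityʳ (c r))) (at-most-twice r))
  ... | no r∉  = subst (λ k → k + c (⊖ r) ≤ 2) (sym (absent r∉)) (at-most-twice (⊖ r))

  weight-pairs≤ : ∀ rs → N (pairs rs) ≤ 2 * length rs
  weight-pairs≤ []       = z≤n
  weight-pairs≤ (r ∷ rs) = subst (N (pairs (r ∷ rs)) ≤_) (sym (*-suc 2 (length rs)))
    (subst (_≤ 2 + 2 * length rs) (+-assoc (c r) (c (⊖ r)) _)
      (+-mono-≤ (pair-weight≤ r) (weight-pairs≤ rs)))

  weight-bound : ∀ A rs → N A + N (pairs rs) ≤ 2 * (length A + length rs)
  weight-bound A rs = subst (N A + N (pairs rs) ≤_) (sym (*-distribˡ-+ 2 (length A) (length rs)))
    (+-mono-≤ (weight≤ A) (weight-pairs≤ rs))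

  weightedSum-saturated : ∀ xs → N xs ≡ 2 * length xs → W xs ≡ σ xs ⊕ σ xs
  weightedSum-saturated []       _ = refl
  weightedSum-saturated (x ∷ xs) N≡2|xs| =
    let cx≡2 , Nxs≡2|xs| = +-tight (at-most-twice x) (weight≤ xs) (trans N≡2|xs| (*-suc 2 (length xs)))
    in begin
      (c x · x) ⊕ W xs
        ≡⟨ cong₂ (λ k w → (k · x) ⊕ w) cx≡2 (weightedSum-saturated xs Nxs≡2|xs|) ⟩
      (x ⊕ (x ⊕ 0G)) ⊕ (σ xs ⊕ σ xs)
        ≡⟨ cong (λ y → (x ⊕ y) ⊕ (σ xs ⊕ σ xs)) (⊕-identityʳ x) ⟩
      (x ⊕ x) ⊕ (σ xs ⊕ σ xs)
        ≡⟨ ⊕-Properties.interchange x x (σ xs) (σ xs) ⟩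
      σ (x ∷ xs) ⊕ σ (x ∷ xs) ∎

  compatible : ∀ {x A} → x ∉ A → 0 < c x → All (λ y → 0 < c y) A → Compatible x A
  compatible x∉A x∈ A-present = All.tabulate λ y∈A z∈A →
    no-zero-sum-triple _ _ (λ { refl → x∉A y∈A }) x∈
      (All.lookup A-present y∈A) (All.lookup A-present z∈A)

  mutual
    search-sound : ∀ {n} rs A → Search n rs A → Unique (pairs rs) → All (_∉ pairs rs) A →
                   All (λ y → 0 < c y) A → Vanishes (2 * n) A (pairs rs)
    search-sound rs A (inj₁ short) _ _ _ N≡2n =
      ⊥-elim (<⇒≢ (≤-<-trans (weight-bound A rs) (*-monoʳ-< 2 short)) N≡2n)
    search-sound rs A (inj₂ branch) = branch-sound rs A branch

    branch-sound : ∀ {n} rs A → Branch n rs A → Unique (pairs rs) → All (_∉ pairs rs) A →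
                   All (λ y → 0 < c y) A → Vanishes (2 * n) A (pairs rs)
    branch-sound [] A (|A|≡n , σA≡0G) _ _ _ N≡2n = begin
      W A ⊕ 0G  ≡⟨ ⊕-identityʳ (W A) ⟩
      W A       ≡⟨ weightedSum-saturated A NA≡2|A| ⟩
      σ A ⊕ σ A ≡⟨ cong₂ _⊕_ σA≡0G σA≡0G ⟩
      0G        ∎
      where
      NA≡2|A| : N A ≡ 2 * length A
      NA≡2|A| = trans (sym (+-identityʳ (N A))) (trans N≡2n (cong (2 *_) (sym |A|≡n)))
    branch-sound {n} (r ∷ rs) A (skip , take-r , take-⊖r) ((_ ∷ r∉rs) ∷ (⊖r∉rs ∷ rs-unique))
                 A-fresh A-present = by-presence (0 <? c r) (0 <? c (⊖ r))
      where
      take : ∀ {x} → x ∉ A → All (x ≢_) (pairs rs) → 0 < c x → (Compatible x A → Search n rs (x ∷ A)) →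
             Vanishes (2 * n) (x ∷ A) (pairs rs)
      take x∉A x∉rs x∈ extend = search-sound rs _ (extend (compatible x∉A x∈ A-present))
        rs-unique (All¬⇒¬Any x∉rs ∷ fresh-tail A-fresh) (x∈ ∷ A-present)

      by-presence : Dec (0 < c r) → Dec (0 < c (⊖ r)) → Vanishes (2 * n) A (pairs (r ∷ rs))
      by-presence (yes r∈) (yes ⊖r∈) = ⊥-elim (no-antipodal-pair r r∈ ⊖r∈)
      by-presence (yes r∈) (no  ⊖r∉) =
        shift-∷ A (⊖ r ∷ pairs rs) r
          (absent-∷ (r ∷ A) (pairs rs) (absent ⊖r∉) (take (fresh⇒∉ A-fresh (here refl)) r∉rs r∈ take-r))
      by-presence (no  r∉) (yes ⊖r∈) =
        absent-∷ A (⊖ r ∷ pairs rs) (absent r∉)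
          (shift-∷ A (pairs rs) (⊖ r) (take (fresh⇒∉ A-fresh (there (here refl))) ⊖r∉rs ⊖r∈ take-⊖r))
      by-presence (no  r∉) (no  ⊖r∉) =
        absent-∷ A (⊖ r ∷ pairs rs) (absent r∉)
          (absent-∷ A (pairs rs) (absent ⊖r∉)
            (search-sound rs A skip rs-unique (fresh-tail A-fresh) A-present))

σ≡0G-by-search : ∀ {n rs} → (∀ x → count x (0G ∷ pairs rs) ≡ 1) → Unique (pairs rs) → Search n rs [] →
                 ∀ S → length S ≡ 2 * n → HasNoShortZeroSum S → σ S ≡ 0G
σ≡0G-by-search {n} {rs} cover rs-unique search S |S|≡2n no-short = begin
  σ S                  ≡⟨ σ≡weightedSum-count cover S ⟩
  weightedSum c U      ≡⟨ ⊕-identityˡ (weightedSum c U) ⟨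
  0G ⊕ weightedSum c U ≡⟨ vanishes (trans (sym (length≡weight-count cover S)) |S|≡2n) ⟩
  0G                   ∎
  where
  open ≡-Reasoning
  U : List G
  U = 0G ∷ pairs rs
  c : G → ℕ
  c x = count x S
  free : ShortZeroSumFree c
  free = shortZeroSumFree no-short
  vanishes : Vanishes free (2 * n) [] U
  vanishes = absent-∷ free [] (pairs rs) (ShortZeroSumFree.zero-absent free)
    (search-sound free rs [] search rs-unique [] [])

reps : List G
reps = (t , t , z) ∷ (o , o , t) ∷ (z , z , t) ∷ (o , z , o) ∷ (t , t , t) ∷ (t , o , z) ∷ (z , o , o)
     ∷ (t , z , o) ∷ (o , z , z) ∷ (t , o , t) ∷ (z , o , z) ∷ (o , t , t) ∷ (z , t , o) ∷ []
  where
  z o t : C3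
  z = Fin.zero
  o = Fin.suc Fin.zero
  t = Fin.suc (Fin.suc Fin.zero)

opaque
  unfolding count

  pairs-reps-cover : ∀ x → count x (0G ∷ pairs reps) ≡ 1
  pairs-reps-cover = from-yes (all? λ x → count x (0G ∷ pairs reps) ≟ℕ 1)

pairs-reps-unique : Unique (pairs reps)
pairs-reps-unique = from-yes (unique? (pairs reps))

search-reps : Search 8 reps []
search-reps = search-correct 8 reps [] _

lemma4p8 : (S : Seq) → length S ≡ 16 → HasNoShortZeroSum S → σ S ≡ 0G
lemma4p8 = σ≡0G-by-search pairs-reps-cover pairs-reps-unique search-reps
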